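{- Suppose the algebraic semantics is complete for intuitionistic propositional logic, i.e. every formula $\varphi$ with $[\![\varphi]\!]_H=1$ for every Heyting algebra $H$ and every assignment $[\![p]\!]_H\in H$ of the propositional variables is provable. Then the stable semantics is complete: every formula $\varphi$ such that $w\Vdash_{\mathcal{M}}\varphi$ for every stable model $\mathcal{M}=(W,\sqsubseteq,V)$ and every $w\in W$ is provable in intuitionistic propositional logic.
   Context: A stable frame is a distributive lattice $(W,\sqsubseteq)$ with bottom $0$ and top $1$. A filter is an upward closed subset containing $1$ and closed under binary meets. A stable model is $(W,\sqsubseteq,V)$ with $V$ assigning to each propositional variable a filter. Formulas are built from variables, $\top,\bot,\wedge,\vee,\to$. Forcing: $w\Vdash p$ iff $w\in V(p)$; $w\Vdash\top$ always; $w\Vdash\bot$ iff $w=1$; $w\Vdash\varphi\wedge\psi$ iff both hold; $w\Vdash\varphi\vee\psi$ iff there exist $v_1,v_2$ with $v_1\wedge v_2\sqsubseteq w$, $v_1\Vdash\varphi$, $v_2\Vdash\psi$; $w\Vdash\varphi\to\psi$ iff for all $v\sqsupseteq w$, $v\Vdash\varphi$ implies $v\Vdash\psi$. For a Heyting algebra $H$, $[\![\varphi]\!]_H$ is the usual recursive interpretation using the Heyting operations. -}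

module Defs where

open import Level using (Level; _⊔_; suc)
open import Data.Nat using (ℕ)
open import Data.List using (List; []; _∷_)
open import Data.List.Membership.Propositional using (_∈_)
open import Data.Product using (Σ; ∃; _×_; _,_)
open import Relation.Binary.Core using (Rel)
open import Relation.Binary.Definitions using (Maximum; Minimum)
open import Relation.Binary.Lattice.Structures using (IsDistributiveLattice)
open import Relation.Binary.Lattice.Bundles using (HeytingAlgebra)
open import Algebra.Core using (Op₂)
open import Data.Unit using () renaming (⊤ to Unit)

infixr 6 _∧'_
infixr 5 _∨'_
infixr 4 _⇒_

data Formula : Set where
  var  : ℕ → Formula
  ⊤'   : Formula
  ⊥'   : Formula
  _∧'_ : Formula → Formula → Formula
  _∨'_ : Formula → Formula → Formula
  _⇒_  : Formula → Formula → Formula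

Ctx : Set
Ctx = List Formula

infix 2 _⊢_

data _⊢_ (Γ : Ctx) : Formula → Set where
  ax    : ∀ {φ} → φ ∈ Γ → Γ ⊢ φ
  ⊤-I   : Γ ⊢ ⊤'
  ⊥-E   : ∀ {φ} → Γ ⊢ ⊥' → Γ ⊢ φ
  ∧-I   : ∀ {φ ψ} → Γ ⊢ φ → Γ ⊢ ψ → Γ ⊢ φ ∧' ψ
  ∧-E₁  : ∀ {φ ψ} → Γ ⊢ φ ∧' ψ → Γ ⊢ φ
  ∧-E₂  : ∀ {φ ψ} → Γ ⊢ φ ∧' ψ → Γ ⊢ ψ
  ∨-I₁  : ∀ {φ ψ} → Γ ⊢ φ → Γ ⊢ φ ∨' ψ
  ∨-I₂  : ∀ {φ ψ} → Γ ⊢ ψ → Γ ⊢ φ ∨' ψ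
  ∨-E   : ∀ {φ ψ χ} → Γ ⊢ φ ∨' ψ → (φ ∷ Γ) ⊢ χ → (ψ ∷ Γ) ⊢ χ → Γ ⊢ χ
  ⇒-I   : ∀ {φ ψ} → (φ ∷ Γ) ⊢ ψ → Γ ⊢ φ ⇒ ψ
  ⇒-E   : ∀ {φ ψ} → Γ ⊢ φ ⇒ ψ → Γ ⊢ φ → Γ ⊢ ψ

Provable : Formula → Set
Provable φ = [] ⊢ φ

module _ {c ℓ₁ ℓ₂ : Level} (H : HeytingAlgebra c ℓ₁ ℓ₂) where
  open HeytingAlgebra H

  ⟦_⟧ : Formula → (ℕ → Carrier) → Carrier
  ⟦ var p ⟧ ρ = ρ p
  ⟦ ⊤' ⟧ ρ = ⊤
  ⟦ ⊥' ⟧ ρ = ⊥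
  ⟦ φ ∧' ψ ⟧ ρ = ⟦ φ ⟧ ρ ∧ ⟦ ψ ⟧ ρ
  ⟦ φ ∨' ψ ⟧ ρ = ⟦ φ ⟧ ρ ∨ ⟦ ψ ⟧ ρ
  ⟦ φ ⇒ ψ ⟧ ρ = ⟦ φ ⟧ ρ ⇨ ⟦ ψ ⟧ ρ

AlgValid : (c ℓ₁ ℓ₂ : Level) → Formula → Set (suc (c ⊔ ℓ₁ ⊔ ℓ₂))
AlgValid c ℓ₁ ℓ₂ φ =
  (H : HeytingAlgebra c ℓ₁ ℓ₂) (ρ : ℕ → HeytingAlgebra.Carrier H) →
  HeytingAlgebra._≈_ H (⟦_⟧ H φ ρ) (HeytingAlgebra.⊤ H)

record StableFrame (c ℓ₁ ℓ₂ : Level) : Set (suc (c ⊔ ℓ₁ ⊔ ℓ₂)) where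
  field
    Carrier : Set c
    _≈_     : Rel Carrier ℓ₁
    _⊑_     : Rel Carrier ℓ₂
    _⊔ᵂ_    : Op₂ Carrier
    _⊓ᵂ_    : Op₂ Carrier
    𝟘       : Carrier
    𝟙       : Carrier
    isDistributiveLattice : IsDistributiveLattice _≈_ _⊑_ _⊔ᵂ_ _⊓ᵂ_
    maximum : Maximum _⊑_ 𝟙
    minimum : Minimum _⊑_ 𝟘

record IsFilter {c ℓ₁ ℓ₂ ℓ : Level} (F : StableFrame c ℓ₁ ℓ₂)
                (P : StableFrame.Carrier F → Set ℓ) : Set (c ⊔ ℓ₂ ⊔ ℓ) where
  open StableFrame F
  field
    up-closed  : ∀ {x y} → x ⊑ y → P x → P y
    has-top    : P 𝟙
    meet-closed : ∀ {x y} → P x → P y → P (x ⊓ᵂ y)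

record StableModel (c ℓ₁ ℓ₂ : Level) : Set (suc (c ⊔ ℓ₁ ⊔ ℓ₂)) where
  field
    frame : StableFrame c ℓ₁ ℓ₂
    V     : ℕ → StableFrame.Carrier frame → Set ℓ₂
    V-filter : ∀ p → IsFilter frame (V p)

module _ {c ℓ₁ ℓ₂ : Level} (M : StableModel c ℓ₁ ℓ₂) where
  open StableModel M
  open StableFrame frame

  _⊩_ : Carrier → Formula → Set (c ⊔ ℓ₁ ⊔ ℓ₂)
  w ⊩ var p = Level.Lift (c ⊔ ℓ₁ ⊔ ℓ₂) (V p w)
  w ⊩ ⊤' = Level.Lift _ Unit
  w ⊩ ⊥' = Level.Lift (c ⊔ ℓ₂) (w ≈ 𝟙)
  w ⊩ (φ ∧' ψ) = (w ⊩ φ) × (w ⊩ ψ)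
  w ⊩ (φ ∨' ψ) = Σ Carrier λ v₁ → Σ Carrier λ v₂ →
                   ((v₁ ⊓ᵂ v₂) ⊑ w) × (v₁ ⊩ φ) × (v₂ ⊩ ψ)
  w ⊩ (φ ⇒ ψ) = ∀ v → w ⊑ v → v ⊩ φ → v ⊩ ψ

StableValid : (c ℓ₁ ℓ₂ : Level) → Formula → Set (suc (c ⊔ ℓ₁ ⊔ ℓ₂))
StableValid c ℓ₁ ℓ₂ φ =
  (M : StableModel c ℓ₁ ℓ₂) (w : StableFrame.Carrier (StableModel.frame M)) →
  _⊩_ M w φ

-- Read a Heyting algebra H upside down: with the order reversed, ∨ as meet, ⊤ as 0 and ⊥ as 1
-- it is a stable frame, and for each a the set ↓a = {w | w ≤ a} is a filter of it.  Valuing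
-- each variable p by ↓ρ(p), a world w forces φ exactly when w ≤ ⟦φ⟧ρ.  So if φ is stably
-- valid then ⊤ ≤ ⟦φ⟧ρ, i.e. φ is algebraically valid, and algebraic completeness applies.
module Submission where

open import Defs
open import Level using (Level; lift)
open import Data.Nat using (ℕ)
open import Data.Product using (_,_)
open import Function using (flip)
open import Relation.Binary.Lattice.Bundles using (HeytingAlgebra)
import Relation.Binary.Lattice.Properties.HeytingAlgebra as HeytingProperties
import Relation.Binary.Lattice.Properties.Lattice as LatticeProperties
import Relation.Binary.Lattice.Properties.DistributiveLattice as DistributiveProperties
import Relation.Binary.Lattice.Properties.JoinSemilattice as JoinProperties

module _ {c ℓ₁ ℓ₂ : Level} (H : HeytingAlgebra c ℓ₁ ℓ₂) where
  open HeytingAlgebra H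
  open HeytingProperties H using (⇨-applyʳ; distributiveLattice)

  dualFrame : StableFrame c ℓ₁ ℓ₂
  dualFrame = record
    { Carrier = Carrier ; _≈_ = _≈_ ; _⊑_ = flip _≤_
    ; _⊔ᵂ_ = _∧_ ; _⊓ᵂ_ = _∨_ ; 𝟘 = ⊤ ; 𝟙 = ⊥
    ; isDistributiveLattice = record
      { isLattice = LatticeProperties.∧-∨-isLattice lattice
      ; ∧-distribˡ-∨ = DistributiveProperties.∨-distribˡ-∧ distributiveLattice }
    ; maximum = minimum ; minimum = maximum }

  downset-isFilter : ∀ a → IsFilter dualFrame (λ w → w ≤ a)
  downset-isFilter a = record
    { up-closed = trans
    ; has-top = minimum a
    ; meet-closed = ∨-least }

  dualModel : (ℕ → Carrier) → StableModel c ℓ₁ ℓ₂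
  dualModel ρ = record
    { frame = dualFrame ; V = λ p w → w ≤ ρ p
    ; V-filter = λ p → downset-isFilter (ρ p) }

  module TruthLemma (ρ : ℕ → Carrier) where
    private
      _⊩ᴴ_ : Carrier → Formula → Set _
      _⊩ᴴ_ = _⊩_ (dualModel ρ)

      ⟦_⟧ρ : Formula → Carrier
      ⟦ φ ⟧ρ = ⟦_⟧ H φ ρ

    mutual
      forces⇒≤⟦⟧ : ∀ φ w → w ⊩ᴴ φ → w ≤ ⟦ φ ⟧ρ
      forces⇒≤⟦⟧ (var p) w (lift w≤ρp) = w≤ρp
      forces⇒≤⟦⟧ ⊤' w _ = maximum w
      forces⇒≤⟦⟧ ⊥' w (lift w≈⊥) = reflexive w≈⊥
      forces⇒≤⟦⟧ (φ ∧' ψ) w (wφ , wψ) =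
        ∧-greatest (forces⇒≤⟦⟧ φ w wφ) (forces⇒≤⟦⟧ ψ w wψ)
      forces⇒≤⟦⟧ (φ ∨' ψ) w (v₁ , v₂ , w≤v₁∨v₂ , v₁φ , v₂ψ) =
        trans w≤v₁∨v₂ (JoinProperties.∨-monotonic joinSemilattice
                        (forces⇒≤⟦⟧ φ v₁ v₁φ) (forces⇒≤⟦⟧ ψ v₂ v₂ψ))
      -- w ∧ ⟦φ⟧ lies above w in the frame order and forces φ, hence forces ψ.
      forces⇒≤⟦⟧ (φ ⇒ ψ) w w⊩φ⇒ψ = transpose-⇨
        (forces⇒≤⟦⟧ ψ (w ∧ ⟦ φ ⟧ρ)
          (w⊩φ⇒ψ _ (x∧y≤x _ _) (≤⟦⟧⇒forces φ _ (x∧y≤y _ _))))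

      ≤⟦⟧⇒forces : ∀ φ w → w ≤ ⟦ φ ⟧ρ → w ⊩ᴴ φ
      ≤⟦⟧⇒forces (var p) w w≤ρp = lift w≤ρp
      ≤⟦⟧⇒forces ⊤' w _ = lift _
      ≤⟦⟧⇒forces ⊥' w w≤⊥ = lift (antisym w≤⊥ (minimum w))
      ≤⟦⟧⇒forces (φ ∧' ψ) w w≤ =
        ≤⟦⟧⇒forces φ w (trans w≤ (x∧y≤x _ _)) , ≤⟦⟧⇒forces ψ w (trans w≤ (x∧y≤y _ _))
      ≤⟦⟧⇒forces (φ ∨' ψ) w w≤ =
        ⟦ φ ⟧ρ , ⟦ ψ ⟧ρ , w≤ , ≤⟦⟧⇒forces φ _ refl , ≤⟦⟧⇒forces ψ _ refl
      ≤⟦⟧⇒forces (φ ⇒ ψ) w w≤ v v≤w vφ = ≤⟦⟧⇒forces ψ v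
        (trans (∧-greatest refl (trans v≤w w≤)) (⇨-applyʳ (forces⇒≤⟦⟧ φ v vφ)))

  stableValid⇒algValid : ∀ φ → StableValid c ℓ₁ ℓ₂ φ → ∀ ρ → ⟦_⟧ H φ ρ ≈ ⊤
  stableValid⇒algValid φ valid ρ =
    antisym (maximum _) (forces⇒≤⟦⟧ φ ⊤ (valid (dualModel ρ) ⊤))
    where open TruthLemma ρ

theorem3p10 : (c ℓ₁ ℓ₂ : Level) →
    ((φ : Formula) → AlgValid c ℓ₁ ℓ₂ φ → Provable φ) →
    (φ : Formula) → StableValid c ℓ₁ ℓ₂ φ → Provable φ
theorem3p10 c ℓ₁ ℓ₂ algComplete φ valid =
  algComplete φ λ H → stableValid⇒algValid H φ valid
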